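{- No square-free odd positive integer is a strong or a weak alpha number of order $(1,1)$.
   Context: For a positive integer $n$, $\sigma(n)=\sum_{d\mid n} d$; $\omega(n)$ is the number of distinct prime divisors of $n$; $\tau(n)$ is the number of positive divisors of $n$. A positive integer $n$ is a strong alpha number of order $(1,1)$ if there exist coprime positive integers $\alpha_1,\alpha_2$ with $\sigma(n)=\frac{\alpha_1}{\alpha_2}n$ and $2\le \max(\alpha_1,\alpha_2)\le \omega(n)$; it is a weak alpha number of order $(1,1)$ if there exist coprime positive integers $\alpha_1,\alpha_2$ with $\sigma(n)=\frac{\alpha_1}{\alpha_2}n$ and $2\le \omega(n)<\max(\alpha_1,\alpha_2)\le \tau(n)$. -}

module Defs where

open import Data.Nat using (ℕ; suc; _*_; _≤_; _<_; _⊔_)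
open import Data.Nat.Divisibility using (_∣_; _∣?_)
open import Data.Nat.Primality using (Prime; prime?)
open import Data.Nat.Coprimality using (Coprime)
open import Data.List using (List; filter; upTo; drop; length)
open import Data.Nat.ListAction using (sum)
open import Data.Product using (∃₂; _×_)
open import Relation.Nullary using (¬_)
open import Relation.Binary.PropositionalEquality using (_≡_)

divisors : ℕ → List ℕ
divisors n = filter (λ d → d ∣? n) (drop 1 (upTo (suc n)))

σ : ℕ → ℕ
σ n = sum (divisors n)

τ : ℕ → ℕ
τ n = length (divisors n)

ω : ℕ → ℕ
ω n = length (filter prime? (divisors n))

SquareFree : ℕ → Set
SquareFree n = ∀ p → Prime p → ¬ (p * p ∣ n)

Odd : ℕ → Set
Odd n = ¬ (2 ∣ n)

-- σ(n) = (α₁/α₂) n with α₁, α₂ coprime positive integers, written as α₂ σ(n) = α₁ n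
StrongAlpha11 : ℕ → Set
StrongAlpha11 n = ∃₂ λ α₁ α₂ → 1 ≤ α₁ × 1 ≤ α₂ × Coprime α₁ α₂ × α₂ * σ n ≡ α₁ * n
  × 2 ≤ α₁ ⊔ α₂ × α₁ ⊔ α₂ ≤ ω n

WeakAlpha11 : ℕ → Set
WeakAlpha11 n = ∃₂ λ α₁ α₂ → 1 ≤ α₁ × 1 ≤ α₂ × Coprime α₁ α₂ × α₂ * σ n ≡ α₁ * n
  × 2 ≤ ω n × ω n < α₁ ⊔ α₂ × α₁ ⊔ α₂ ≤ τ n

-- For odd square-free n = p₁⋯pₖ, σ n = ∏ (pᵢ + 1) = 2ᵏ c with c = ∏ (pᵢ + 1)/2, and τ n = 2ᵏ.
-- If α₂ σ n = α₁ n then, n being odd, 2ᵏ ∣ α₁. The case α₁ = 2ᵏ would give c ∣ n, so the half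
-- (q + 1)/2 of the least prime factor q of n would divide n although its prime factors lie below q.
-- Hence α₁ > τ n ≥ ω n, which rules out both the strong and the weak case.
module Submission where

open import Defs
open import Data.Nat
open import Data.Nat.Properties
open import Data.Nat.Divisibility
open import Data.Nat.Primality
open import Data.Nat.Coprimality using (gcd≡1⇒coprime; coprime-divisor)
open import Data.Nat.GCD using (gcd[m,n]∣m; gcd[m,n]∣n)
open import Data.Nat.Induction using (<-rec)
open import Data.Nat.ListAction using (sum; product)
open import Data.Nat.ListAction.Properties using (sum-++; sum-↭)
open import Data.Nat.Primality.Factorisation using (factorise; PrimeFactorisation)
open import Data.Nat.Solver using (module +-*-Solver)
open import Data.List using (List; []; _∷_; map; _++_; length; applyUpTo)
open import Data.List.Properties using (length-++; length-map; length-filter)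
open import Data.List.Membership.Propositional using (_∈_)
open import Data.List.Membership.Propositional.Properties
  using (∈-filter⁻; ∈-filter⁺; ∈-applyUpTo⁺; ∈-++⁺ˡ; ∈-++⁺ʳ; ∈-++⁻; ∈-map⁺; ∈-map⁻)
open import Data.List.Membership.Propositional.Properties.WithK using (unique∧set⇒bag)
open import Data.List.Relation.Unary.All using (All; []; _∷_)
open import Data.List.Relation.Unary.Unique.Propositional using (Unique)
import Data.List.Relation.Unary.Unique.Propositional.Properties as Unique
open import Data.List.Relation.Binary.BagAndSetEquality using (∼bag⇒↭)
open import Data.List.Relation.Binary.Permutation.Propositional using (_↭_)
open import Data.List.Relation.Binary.Permutation.Propositional.Properties using (↭-length)
open import Data.Product using (∃; ∃₂; _×_; _,_; proj₂)
open import Data.Sum using (_⊎_; inj₁; inj₂)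
open import Function.Base using (_∘_)
open import Function.Bundles using (mk⇔)
open import Relation.Nullary using (¬_; contradiction)
open import Relation.Binary.PropositionalEquality

open +-*-Solver using (solve; _:*_; _:=_; con)

private variable d m n p q h α₁ α₂ : ℕ

∈-divisors⁻ : d ∈ divisors n → d ∣ n
∈-divisors⁻ {n = n} d∈ = proj₂ (∈-filter⁻ (_∣? n) {xs = applyUpTo suc n} d∈)

∈-divisors⁺ : .{{NonZero n}} → d ∣ n → d ∈ divisors n
∈-divisors⁺ {n = suc n} {d = zero}  0∣n = contradiction (0∣⇒≡0 0∣n) λ ()
∈-divisors⁺ {n = suc n} {d = suc d} d∣n = ∈-filter⁺ (_∣? suc n) (∈-applyUpTo⁺ suc (∣⇒≤ d∣n)) d∣n

divisors-unique : ∀ n → Unique (divisors n)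
divisors-unique n =
  Unique.filter⁺ (_∣? n) (Unique.applyUpTo⁺₁ suc n (λ i<j _ → <⇒≢ i<j ∘ suc-injective))

ω≤τ : ∀ n → ω n ≤ τ n
ω≤τ n = length-filter prime? (divisors n)

prime-∣-*⇒∣⊎∣ : Prime p → d ∣ p * m → p ∣ d ⊎ d ∣ m
prime-∣-*⇒∣⊎∣ {p} {d} prime-p d∣pm with prime⇒irreducible prime-p (gcd[m,n]∣n d p)
... | inj₁ gcd≡1 = inj₂ (coprime-divisor (gcd≡1⇒coprime gcd≡1) d∣pm)
... | inj₂ gcd≡p = inj₁ (subst (_∣ d) gcd≡p (gcd[m,n]∣m d p))

sum-map-*ˡ : ∀ p (ms : List ℕ) → sum (map (p *_) ms) ≡ p * sum ms
sum-map-*ˡ p []       = sym (*-zeroʳ p)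
sum-map-*ˡ p (m ∷ ms) = trans (cong (p * m +_) (sum-map-*ˡ p ms)) (sym (*-distribˡ-+ p m (sum ms)))

module _ (prime-p : Prime p) (p∤m : ¬ p ∣ m) .{{_ : NonZero m}} where
  private instance
    p≢0 : NonZero p
    p≢0 = prime⇒nonZero prime-p
    p*m≢0 : NonZero (p * m)
    p*m≢0 = m*n≢0 p m

  divisors-*-prime : divisors (p * m) ↭ divisors m ++ map (p *_) (divisors m)
  divisors-*-prime = ∼bag⇒↭ (unique∧set⇒bag (divisors-unique (p * m)) unique (mk⇔ to from))
    where
    to : d ∈ divisors (p * m) → d ∈ divisors m ++ map (p *_) (divisors m)
    to d∈ with prime-∣-*⇒∣⊎∣ prime-p (∈-divisors⁻ d∈)
    ... | inj₂ d∣m = ∈-++⁺ˡ (∈-divisors⁺ d∣m)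
    ... | inj₁ (divides e refl) =
      ∈-++⁺ʳ (divisors m) (subst (_∈ map (p *_) (divisors m)) (*-comm p e) (∈-map⁺ (p *_) (∈-divisors⁺ e∣m)))
      where
      e∣m : e ∣ m
      e∣m = *-cancelˡ-∣ p (subst (_∣ p * m) (*-comm e p) (∈-divisors⁻ d∈))

    from : d ∈ divisors m ++ map (p *_) (divisors m) → d ∈ divisors (p * m)
    from d∈ with ∈-++⁻ (divisors m) d∈
    ... | inj₁ d∈m = ∈-divisors⁺ (∣n⇒∣m*n p (∈-divisors⁻ d∈m))
    ... | inj₂ d∈pm with ∈-map⁻ (p *_) d∈pm
    ...   | e , e∈m , refl = ∈-divisors⁺ (*-monoʳ-∣ p (∈-divisors⁻ e∈m))

    disjoint : ¬ (d ∈ divisors m × d ∈ map (p *_) (divisors m))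
    disjoint (d∈m , d∈pm) with ∈-map⁻ (p *_) d∈pm
    ... | e , _ , refl = p∤m (∣-trans (m∣m*n e) (∈-divisors⁻ d∈m))

    unique : Unique (divisors m ++ map (p *_) (divisors m))
    unique = Unique.++⁺ (divisors-unique m) (Unique.map⁺ (*-cancelˡ-≡ _ _ p) (divisors-unique m)) disjoint

  σ-*-prime : σ (p * m) ≡ (1 + p) * σ m
  σ-*-prime = begin
    σ (p * m)                                   ≡⟨ sum-↭ divisors-*-prime ⟩
    sum (divisors m ++ map (p *_) (divisors m)) ≡⟨ sum-++ (divisors m) _ ⟩
    σ m + sum (map (p *_) (divisors m))         ≡⟨ cong (σ m +_) (sum-map-*ˡ p (divisors m)) ⟩
    σ m + p * σ m                               ∎
    where open ≡-Reasoning

  τ-*-prime : τ (p * m) ≡ 2 * τ m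
  τ-*-prime = begin
    τ (p * m)                                      ≡⟨ ↭-length divisors-*-prime ⟩
    length (divisors m ++ map (p *_) (divisors m)) ≡⟨ length-++ (divisors m) ⟩
    τ m + length (map (p *_) (divisors m))         ≡⟨ cong (τ m +_) (length-map (p *_) (divisors m)) ⟩
    τ m + τ m                                      ≡⟨ cong (τ m +_) (+-identityʳ (τ m)) ⟨
    2 * τ m                                        ∎
    where open ≡-Reasoning

squareFree-∣ : d ∣ n → SquareFree n → SquareFree d
squareFree-∣ d∣n sf p prime-p pp∣d = sf p prime-p (∣-trans pp∣d d∣n)

odd-∣ : d ∣ n → Odd n → Odd d
odd-∣ d∣n odd 2∣d = odd (∣-trans 2∣d d∣n)

odd⇒1+n≡2* : Odd n → ∃ λ h → 1 + n ≡ 2 * h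
odd⇒1+n≡2* {zero}        odd = contradiction (divides 0 refl) odd
odd⇒1+n≡2* {suc zero}    _   = 1 , refl
odd⇒1+n≡2* {suc (suc n)} odd with odd⇒1+n≡2* {n} (odd ∘ ∣m∣n⇒∣m+n ∣-refl)
... | h , 1+n≡2h = suc h , trans (cong (2 +_) 1+n≡2h) (sym (*-suc 2 h))

-- σ n = 2ᵏ c and τ n = 2ᵏ where, for square-free n, c = ∏ (q + 1)/2 over the prime factors q of n;
-- of that product only the divisibility of c by each factor (q + 1)/2 is recorded.
record HalvedDivisorSum (n : ℕ) : Set where
  constructor halved
  field
    k c      : ℕ
    σ≡2^k*c  : σ n ≡ 2 ^ k * c
    τ≡2^k    : τ n ≡ 2 ^ k
    halves-∣ : ∀ q → Prime q → q ∣ n → ∃ λ h → 1 + q ≡ 2 * h × h ∣ c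

halved-1 : HalvedDivisorSum 1
halved-1 = halved 0 1 refl refl λ q prime-q q∣1 → contradiction (subst Prime (∣1⇒≡1 q∣1) prime-q) ¬prime[1]

halved-*-prime : Prime p → ¬ p ∣ n → .{{NonZero n}} → Odd p →
                 HalvedDivisorSum n → HalvedDivisorSum (p * n)
halved-*-prime {p} {n} prime-p p∤n odd-p (halved k c σ≡ τ≡ halves) with odd⇒1+n≡2* odd-p
... | h , 1+p≡2h = halved (suc k) (h * c) σ≡′ τ≡′ halves′
  where
  σ≡′ : σ (p * n) ≡ 2 ^ suc k * (h * c)
  σ≡′ = begin
    σ (p * n)             ≡⟨ σ-*-prime prime-p p∤n ⟩
    (1 + p) * σ n         ≡⟨ cong₂ _*_ 1+p≡2h σ≡ ⟩
    (2 * h) * (2 ^ k * c) ≡⟨ solve 3 (λ h t c → (con 2 :* h) :* (t :* c) := (con 2 :* t) :* (h :* c))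
                                     refl h (2 ^ k) c ⟩
    2 ^ suc k * (h * c)   ∎
    where open ≡-Reasoning

  τ≡′ : τ (p * n) ≡ 2 ^ suc k
  τ≡′ = trans (τ-*-prime prime-p p∤n) (cong (2 *_) τ≡)

  halves′ : ∀ q → Prime q → q ∣ p * n → ∃ λ h′ → 1 + q ≡ 2 * h′ × h′ ∣ h * c
  halves′ q prime-q q∣pn with euclidsLemma p n prime-q q∣pn
  ... | inj₂ q∣n with halves q prime-q q∣n
  ...   | h′ , 1+q≡2h′ , h′∣c = h′ , 1+q≡2h′ , ∣n⇒∣m*n h h′∣c
  halves′ q prime-q q∣pn | inj₁ q∣p with prime⇒irreducible prime-p q∣p
  ... | inj₁ refl = contradiction prime-q ¬prime[1]
  ... | inj₂ refl = h , 1+p≡2h , m∣m*n c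

halved-product : ∀ {ps} → All Prime ps → SquareFree (product ps) → Odd (product ps) →
                 HalvedDivisorSum (product ps)
halved-product []                         _  _   = halved-1
halved-product {p ∷ ps} (prime-p ∷ primes) sf odd =
  halved-*-prime prime-p p∤ps {{productOfPrimes≢0 primes}} (odd-∣ (m∣m*n (product ps)) odd)
    (halved-product primes (squareFree-∣ (n∣m*n p) sf) (odd-∣ (n∣m*n p) odd))
  where
  p∤ps : ¬ p ∣ product ps
  p∤ps p∣ps = sf p prime-p (*-monoʳ-∣ p p∣ps)

squareFree∧odd⇒halved : .{{NonZero n}} → SquareFree n → Odd n → HalvedDivisorSum n
squareFree∧odd⇒halved {n} sf odd = subst HalvedDivisorSum (sym n≡Πps)
  (halved-product primes (subst SquareFree n≡Πps sf) (subst Odd n≡Πps odd))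
  where open PrimeFactorisation (factorise n) renaming (isFactorisation to n≡Πps; factorsPrime to primes)

∃-prime-∣ : 1 < n → ∃ λ p → Prime p × p ∣ n
∃-prime-∣ {n} 1<n with factorise n {{>-nonZero (<-trans z<s 1<n)}}
... | record { factors = [] ; isFactorisation = refl } = contradiction 1<n (<-irrefl refl)
... | record { factors = p ∷ ps ; isFactorisation = refl ; factorsPrime = prime-p ∷ _ } =
  p , prime-p , m∣m*n (product ps)

half-bounds : 1 < q → 1 + q ≡ 2 * h → 1 < h × h < q
half-bounds {q} {h} 1<q 1+q≡2h =
  *-cancelˡ-< 2 1 h (subst (2 <_) 1+q≡2h (s<s 1<q)) ,
  *-cancelˡ-< 2 h q (subst (_< 2 * q) 1+q≡2h 1+q<2q)
  where
  1+q<2q : 1 + q < 2 * q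
  1+q<2q = subst (1 + q <_) (cong (q +_) (sym (+-identityʳ q))) (+-monoˡ-< q 1<q)

halves-∣⇒¬prime-∣ : (∀ q → Prime q → q ∣ n → ∃ λ h → 1 + q ≡ 2 * h × h ∣ n) → Prime q → ¬ q ∣ n
halves-∣⇒¬prime-∣ {n} {q} halves = <-rec (λ q → Prime q → ¬ q ∣ n) descend q
  where
  descend : ∀ q → (∀ {r} → r < q → Prime r → ¬ r ∣ n) → Prime q → ¬ q ∣ n
  descend q below prime-q q∣n with halves q prime-q q∣n
  ... | h , 1+q≡2h , h∣n with half-bounds (nonTrivial⇒n>1 q {{prime⇒nonTrivial prime-q}}) 1+q≡2h
  ... | 1<h , h<q with ∃-prime-∣ 1<h
  ... | r , prime-r , r∣h =
    below (≤-<-trans (∣⇒≤ {{>-nonZero (<-trans z<s 1<h)}} r∣h) h<q) prime-r (∣-trans r∣h h∣n)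

2^k∣m*odd⇒2^k∣m : Odd n → ∀ k m → 2 ^ k ∣ m * n → 2 ^ k ∣ m
2^k∣m*odd⇒2^k∣m odd zero    m _ = 1∣ m
2^k∣m*odd⇒2^k∣m {n} odd (suc k) m 2^1+k∣mn with euclidsLemma m n prime[2] (∣-trans (m∣m*n (2 ^ k)) 2^1+k∣mn)
... | inj₂ 2∣n = contradiction 2∣n odd
... | inj₁ (divides e refl) =
  subst (2 ^ suc k ∣_) (*-comm 2 e) (*-monoʳ-∣ 2 (2^k∣m*odd⇒2^k∣m odd k e (*-cancelˡ-∣ 2 2*2^k∣2*en)))
  where
  2*2^k∣2*en : 2 * 2 ^ k ∣ 2 * (e * n)
  2*2^k∣2*en = subst (2 * 2 ^ k ∣_) (solve 2 (λ e n → (e :* con 2) :* n := con 2 :* (e :* n)) refl e n) 2^1+k∣mn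

module _ {n α₁ α₂ : ℕ} (shape : HalvedDivisorSum n) (eq : α₂ * σ n ≡ α₁ * n) where
  open HalvedDivisorSum shape

  τ∣α₁ : Odd n → τ n ∣ α₁
  τ∣α₁ odd = subst (_∣ α₁) (sym τ≡2^k) (2^k∣m*odd⇒2^k∣m odd k α₁ (divides (α₂ * c) α₁n≡α₂c2^k))
    where
    α₁n≡α₂c2^k : α₁ * n ≡ α₂ * c * 2 ^ k
    α₁n≡α₂c2^k = begin
      α₁ * n             ≡⟨ eq ⟨
      α₂ * σ n           ≡⟨ cong (α₂ *_) σ≡2^k*c ⟩
      α₂ * (2 ^ k * c)   ≡⟨ solve 3 (λ a t c → a :* (t :* c) := (a :* c) :* t) refl α₂ (2 ^ k) c ⟩
      α₂ * c * 2 ^ k     ∎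
      where open ≡-Reasoning

  α₁≢τ : 1 < n → α₁ ≢ τ n
  α₁≢τ 1<n α₁≡τ with ∃-prime-∣ 1<n
  ... | q , prime-q , q∣n = halves-∣⇒¬prime-∣ halves-∣n prime-q q∣n
    where
    instance
      2^k≢0 : NonZero (2 ^ k)
      2^k≢0 = m^n≢0 2 k

    α₂c≡n : α₂ * c ≡ n
    α₂c≡n = *-cancelˡ-≡ (α₂ * c) n (2 ^ k) (begin
      2 ^ k * (α₂ * c)   ≡⟨ solve 3 (λ t a c → t :* (a :* c) := a :* (t :* c)) refl (2 ^ k) α₂ c ⟩
      α₂ * (2 ^ k * c)   ≡⟨ cong (α₂ *_) σ≡2^k*c ⟨
      α₂ * σ n           ≡⟨ eq ⟩
      α₁ * n             ≡⟨ cong (_* n) (trans α₁≡τ τ≡2^k) ⟩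
      2 ^ k * n          ∎)
      where open ≡-Reasoning

    halves-∣n : ∀ q → Prime q → q ∣ n → ∃ λ h → 1 + q ≡ 2 * h × h ∣ n
    halves-∣n q prime-q q∣n with halves-∣ q prime-q q∣n
    ... | h , 1+q≡2h , h∣c = h , 1+q≡2h , ∣-trans h∣c (divides α₂ (sym α₂c≡n))

τ<α₁ : 1 < n → SquareFree n → Odd n → 1 ≤ α₁ → α₂ * σ n ≡ α₁ * n → τ n < α₁
τ<α₁ {α₂ = α₂} 1<n sf odd 1≤α₁ eq =
  ≤∧≢⇒< (∣⇒≤ {{>-nonZero 1≤α₁}} (τ∣α₁ {α₂ = α₂} shape eq odd)) (≢-sym (α₁≢τ {α₂ = α₂} shape eq 1<n))
  where
  shape = squareFree∧odd⇒halved {{>-nonZero (<-trans z<s 1<n)}} sf odd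

alpha11⇒bounded-by-τ : StrongAlpha11 n ⊎ WeakAlpha11 n →
  ∃₂ λ α₁ α₂ → 1 ≤ α₁ × α₂ * σ n ≡ α₁ * n × 2 ≤ α₁ ⊔ α₂ × α₁ ⊔ α₂ ≤ τ n
alpha11⇒bounded-by-τ {n} (inj₁ (α₁ , α₂ , 1≤α₁ , _ , _ , eq , 2≤α , α≤ω)) =
  α₁ , α₂ , 1≤α₁ , eq , 2≤α , ≤-trans α≤ω (ω≤τ n)
alpha11⇒bounded-by-τ (inj₂ (α₁ , α₂ , 1≤α₁ , _ , _ , eq , 2≤ω , ω<α , α≤τ)) =
  α₁ , α₂ , 1≤α₁ , eq , ≤-trans 2≤ω (<⇒≤ ω<α) , α≤τ

theorem3p3 : (n : ℕ) → 1 ≤ n → SquareFree n → Odd n → ¬ (StrongAlpha11 n ⊎ WeakAlpha11 n)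
theorem3p3 n 1≤n sf odd alpha with alpha11⇒bounded-by-τ alpha
... | α₁ , α₂ , 1≤α₁ , eq , 2≤α , α≤τ with m≤n⇒m<n∨m≡n 1≤n
...   | inj₁ 1<n = <⇒≱ (τ<α₁ {α₂ = α₂} 1<n sf odd 1≤α₁ eq) (≤-trans (m≤m⊔n α₁ α₂) α≤τ)
...   | inj₂ refl = contradiction (≤-trans 2≤α α≤τ) λ { (s≤s ()) }
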